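{- For each integer $m\ge 2$ and each integer $k\ge 1$, there exists a constant $C(m,k)$ such that $g_m(kr)\le (k+1)r$ for all $r\in\mathbb{N}$ with $r>C(m,k)$.
   Context: $\mathbb{N}=\{0,1,2,\dots\}$. For an integer $m\ge 2$, an $m$-product sequence is a finite sequence of integers $a_1\le a_2\le\dots\le a_t$ such that $\prod_{i=1}^t a_i=R^m$ for some $R\in\mathbb{N}$ and no integer appears more than $m-1$ times in the sequence. For $n\in\mathbb{N}$, $g_m(n)$ is the least integer $s$ such that there exists an $m$-product sequence $a_1\le\dots\le a_t$ with $a_1=n$ and $a_t=s$. -}

module Defs where

open import Data.Nat using (ℕ; _≤_; _∸_; _^_; _≟_)
open import Data.List using (List; head; last; filter; length)
open import Data.Nat.ListAction using (product)
open import Data.List.Relation.Unary.Linked using (Linked)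
open import Data.Maybe using (Maybe; just)
open import Data.Product using (Σ; ∃; _×_)
open import Relation.Binary.PropositionalEquality using (_≡_)

-- Entries are natural numbers: since a₁ = n ∈ ℕ and
-- the sequence is nondecreasing, all entries are ≥ 0 anyway.
MProductSeq : ℕ → List ℕ → Set
MProductSeq m as =
  Linked _≤_ as
  × (∃ λ R → product as ≡ R ^ m)
  × (∀ x → length (filter (x ≟_) as) ≤ m ∸ 1)

SeqFromTo : ℕ → ℕ → ℕ → Set
SeqFromTo m n s =
  ∃ λ as → MProductSeq m as × head as ≡ just n × last as ≡ just s

IsG : ℕ → ℕ → ℕ → Set
IsG m n s = SeqFromTo m n s × (∀ s' → SeqFromTo m n s' → s ≤ s')

-- Let c = k (k+1)^(m-1) and let t be the largest integer with c t^m ≤ kr.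
-- The sequence consisting of kr repeated m-1 times, then u = c (t+1)^m,
-- then (k+1)r has product (k (k+1) r (t+1))^m.  It is strictly increasing
-- after the run, because kr < u by maximality of t, and u < (k+1)r because
-- k (t+1)^m < (k+1) t^m as soon as t > 2mk, which holds once r is large.
-- A sequence ending in s has at most (s+1)(m-1) entries, all at most s, so
-- the existence of an m-product sequence from n to s is decided by a finite
-- search; hence the least such s, namely g_m(kr), exists and is at most (k+1)r.
module Submission where

open import Defs
open import Data.Nat
  using (ℕ; zero; suc; _+_; _*_; _∸_; _^_; _≤_; _<_; _≟_; _≤?_; NonZero; >-nonZero; z≤n; s≤s; s≤s⁻¹)
open import Data.Nat.Properties
open import Data.Nat.ListAction using (product)
open import Data.Nat.ListAction.Properties using (product-++)
open import Data.Nat.Tactic.RingSolver using (solve-∀)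
open import Algebra.Properties.CommutativeSemigroup *-commutativeSemigroup using (interchange; x∙yz≈y∙xz; xy∙z≈y∙xz)
open import Data.List using (List; []; _∷_; _++_; head; last; filter; length; replicate)
open import Data.List.Properties using (length-++; length-filter; length-replicate; filter-++; filter-all; filter-none; filter-accept; filter-reject)
open import Data.List.Relation.Unary.All using (All; []; _∷_; all?; tabulate)
import Data.List.Relation.Unary.All as All
open import Data.List.Relation.Unary.All.Properties using (replicate⁺; ¬Any⇒All¬)
open import Data.List.Relation.Unary.Any using (any?)
open import Data.List.Relation.Unary.Linked using (Linked; []; [-]; _∷_; linked?)
open import Data.Maybe using (just)
open import Data.Maybe.Properties using (≡-dec)
open import Data.Product using (∃; _×_; _,_; proj₁; proj₂)
open import Data.Sum using (_⊎_; inj₁; inj₂)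
open import Function using (_∘_)
open import Relation.Nullary using (Dec; yes; no; ¬_; contradiction)
open import Relation.Nullary.Decidable using (map′; _×-dec_; _⊎-dec_)
open import Relation.Unary using (Decidable)
open import Relation.Binary.PropositionalEquality using (_≡_; _≢_; refl; sym; trans; cong; cong₂; subst; module ≡-Reasoning)

count : ℕ → List ℕ → ℕ
count x xs = length (filter (x ≟_) xs)

count-++ : ∀ x xs ys → count x (xs ++ ys) ≡ count x xs + count x ys
count-++ x xs ys = trans (cong length (filter-++ (x ≟_) xs ys)) (length-++ (filter (x ≟_) xs))

count-replicate : ∀ n x → count x (replicate n x) ≡ n
count-replicate n x = trans (cong length (filter-all (x ≟_) (replicate⁺ n refl))) (length-replicate n)

count-≡0 : ∀ {x xs} → All (x ≢_) xs → count x xs ≡ 0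
count-≡0 {x} = cong length ∘ filter-none (x ≟_)

count-∷-≡ : ∀ x xs → count x (x ∷ xs) ≡ suc (count x xs)
count-∷-≡ x xs = cong length (filter-accept (x ≟_) refl)

count-∷-≢ : ∀ {x y} xs → x ≢ y → count x (y ∷ xs) ≡ count x xs
count-∷-≢ {x} xs x≢y = cong length (filter-reject (x ≟_) x≢y)

count-∷-≤ : ∀ x y xs → count x xs ≤ count x (y ∷ xs)
count-∷-≤ x y xs with x ≟ y
... | yes refl = subst (count x xs ≤_) (sym (count-∷-≡ x xs)) (n≤1+n _)
... | no x≢y = ≤-reflexive (sym (count-∷-≢ xs x≢y))

count-pair-≤1 : ∀ x {u b} → u ≢ b → count x (u ∷ b ∷ []) ≤ 1
count-pair-≤1 x {u} {b} u≢b with x ≟ u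
... | yes refl = ≤-reflexive (trans (count-∷-≡ x (b ∷ [])) (cong suc (count-≡0 (u≢b ∷ []))))
... | no x≢u = ≤-trans (≤-reflexive (count-∷-≢ (b ∷ []) x≢u)) (length-filter (x ≟_) (b ∷ []))

sumUpTo : ℕ → (ℕ → ℕ) → ℕ
sumUpTo zero f = f 0
sumUpTo (suc s) f = f (suc s) + sumUpTo s f

sumUpTo-mono-≤ : ∀ s {f g} → (∀ x → f x ≤ g x) → sumUpTo s f ≤ sumUpTo s g
sumUpTo-mono-≤ zero f≤g = f≤g 0
sumUpTo-mono-≤ (suc s) f≤g = +-mono-≤ (f≤g (suc s)) (sumUpTo-mono-≤ s f≤g)

sumUpTo-mono-< : ∀ s {f g a} → (∀ x → f x ≤ g x) → a ≤ s → f a < g a → sumUpTo s f < sumUpTo s g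
sumUpTo-mono-< zero f≤g z≤n fa<ga = fa<ga
sumUpTo-mono-< (suc s) {a = a} f≤g a≤1+s fa<ga with a ≟ suc s
... | yes refl = +-mono-<-≤ fa<ga (sumUpTo-mono-≤ s f≤g)
... | no a≢1+s = +-mono-≤-< (f≤g (suc s)) (sumUpTo-mono-< s f≤g (s≤s⁻¹ (≤∧≢⇒< a≤1+s a≢1+s)) fa<ga)

sumUpTo-≤-* : ∀ s {f b} → (∀ x → f x ≤ b) → sumUpTo s f ≤ suc s * b
sumUpTo-≤-* zero {b = b} f≤b = subst (_ ≤_) (sym (+-identityʳ b)) (f≤b 0)
sumUpTo-≤-* (suc s) f≤b = +-mono-≤ (f≤b (suc s)) (sumUpTo-≤-* s f≤b)

length≤sumUpTo-count : ∀ s {xs} → All (_≤ s) xs → length xs ≤ sumUpTo s (λ x → count x xs)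
length≤sumUpTo-count s [] = z≤n
length≤sumUpTo-count s {a ∷ xs} (a≤s ∷ xs≤s) =
  ≤-trans (s≤s (length≤sumUpTo-count s xs≤s))
          (sumUpTo-mono-< s (λ x → count-∷-≤ x a xs) a≤s (≤-reflexive (sym (count-∷-≡ a xs))))

All-≤-last : ∀ {xs s} → Linked _≤_ xs → last xs ≡ just s → All (_≤ s) xs
All-≤-last {_ ∷ []} [-] refl = ≤-refl ∷ []
All-≤-last (x≤y ∷ sorted) lst with All-≤-last sorted lst
... | y≤s ∷ rest = ≤-trans x≤y y≤s ∷ y≤s ∷ rest

length-MProductSeq : ∀ {m xs s} → MProductSeq m xs → last xs ≡ just s → length xs ≤ suc s * (m ∸ 1)
length-MProductSeq {s = s} (sorted , _ , counts) lst =
  ≤-trans (length≤sumUpTo-count s (All-≤-last sorted lst)) (sumUpTo-≤-* s counts)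

n≤n^[1+j] : ∀ n j → n ≤ n ^ suc j
n≤n^[1+j] zero j = z≤n
n≤n^[1+j] n@(suc _) j = m≤m*n n (n ^ j) {{m^n≢0 n j}}

isPower? : ∀ m p → Dec (∃ λ R → p ≡ R ^ m)
isPower? zero p = map′ (0 ,_) proj₂ (p ≟ 1)
isPower? (suc j) p = map′ (λ (R , _ , p≡R^m) → R , p≡R^m)
  (λ (R , p≡R^m) → R , s≤s (subst (R ≤_) (sym p≡R^m) (n≤n^[1+j] R j)) , p≡R^m)
  (anyUpTo? (λ R → p ≟ R ^ suc j) (suc p))

allCounts≤? : ∀ j xs → Dec (∀ x → count x xs ≤ j)
allCounts≤? j xs = map′ everywhere (λ c → tabulate (λ {x} _ → c x)) (all? (λ x → count x xs ≤? j) xs)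
  where
  everywhere : All (λ x → count x xs ≤ j) xs → ∀ x → count x xs ≤ j
  everywhere onMembers x with any? (x ≟_) xs
  ... | yes x∈xs = All.lookup onMembers x∈xs
  ... | no x∉xs = subst (_≤ j) (sym (count-≡0 (¬Any⇒All¬ xs x∉xs))) z≤n

MProductSeq? : ∀ m xs → Dec (MProductSeq m xs)
MProductSeq? m xs = linked? _≤?_ xs ×-dec isPower? m (product xs) ×-dec allCounts≤? (m ∸ 1) xs

BoundedList : ℕ → ℕ → (List ℕ → Set) → Set
BoundedList s L P = ∃ λ xs → length xs ≤ L × All (_≤ s) xs × P xs

anyBoundedList? : ∀ {P : List ℕ → Set} → Decidable P → ∀ s L → Dec (BoundedList s L P)
anyBoundedList? P? s zero =
  map′ (λ p → [] , z≤n , [] , p) (λ { ([] , _ , _ , p) → p ; (_ ∷ _ , () , _) }) (P? [])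
anyBoundedList? {P} P? s (suc L) =
  map′ cons uncons (P? [] ⊎-dec anyUpTo? (λ x → anyBoundedList? (P? ∘ (x ∷_)) s L) (suc s))
  where
  cons : P [] ⊎ (∃ λ x → x < suc s × BoundedList s L (P ∘ (x ∷_))) → BoundedList s (suc L) P
  cons (inj₁ p) = [] , z≤n , [] , p
  cons (inj₂ (x , x<1+s , xs , len≤L , xs≤s , p)) = x ∷ xs , s≤s len≤L , s≤s⁻¹ x<1+s ∷ xs≤s , p
  uncons : BoundedList s (suc L) P → P [] ⊎ (∃ λ x → x < suc s × BoundedList s L (P ∘ (x ∷_)))
  uncons ([] , _ , _ , p) = inj₁ p
  uncons (x ∷ xs , s≤s len≤L , x≤s ∷ xs≤s , p) = inj₂ (x , s≤s x≤s , xs , len≤L , xs≤s , p)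

SeqFromTo? : ∀ m n s → Dec (SeqFromTo m n s)
SeqFromTo? m n s =
  map′ (λ (xs , _ , _ , w) → xs , w)
       (λ (xs , w@(seq , _ , lst)) → xs , length-MProductSeq {m} seq lst , All-≤-last (proj₁ seq) lst , w)
       (anyBoundedList? isSeqFromTo? s (suc s * (m ∸ 1)))
  where
  isSeqFromTo? : ∀ xs → Dec (MProductSeq m xs × head xs ≡ just n × last xs ≡ just s)
  isSeqFromTo? xs = MProductSeq? m xs ×-dec ≡-dec _≟_ (head xs) (just n) ×-dec ≡-dec _≟_ (last xs) (just s)

module _ {P : ℕ → Set} (P? : Decidable P) where

  least : ∀ {n} → P n → ∃ λ s → P s × (∀ s' → P s' → s ≤ s')
  least {n} Pn = leastBelow (suc n) (n , ≤-refl , Pn)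
    where
    leastBelow : ∀ v → (∃ λ x → x < v × P x) → ∃ λ s → P s × (∀ s' → P s' → s ≤ s')
    leastBelow (suc v) (x , x<1+v , Px) with anyUpTo? P? v
    ... | yes below = leastBelow v below
    ... | no none = v , subst P x≡v Px , λ s' Ps' → ≮⇒≥ (λ s'<v → none (s' , s'<v , Ps'))
      where
      x≡v : x ≡ v
      x≡v = ≤-antisym (s≤s⁻¹ x<1+v) (≮⇒≥ (λ x<v → none (x , x<v , Px)))

  lastBefore : ∀ d {a} → P a → ¬ P (d + a) → ∃ λ t → a ≤ t × P t × ¬ P (suc t)
  lastBefore zero Pa ¬Pa = contradiction Pa ¬Pa
  lastBefore (suc d) {a} Pa ¬P[1+d+a] with P? (suc a)
  ... | no ¬P[1+a] = a , ≤-refl , Pa , ¬P[1+a]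
  ... | yes P[1+a] with lastBefore d P[1+a] (subst (¬_ ∘ P) (sym (+-suc d a)) ¬P[1+d+a])
  ...   | t , a<t , Pt , ¬P[1+t] = t , <⇒≤ a<t , Pt , ¬P[1+t]

SeqFromTo⇒∃IsG : ∀ {m n s} → SeqFromTo m n s → ∃ λ g → IsG m n g × g ≤ s
SeqFromTo⇒∃IsG {m} {n} {s} seq =
  let g , seq-g , minimal = least (SeqFromTo? m n) seq in g , (seq-g , minimal) , minimal s seq

n≤c*n^[1+j] : ∀ c j n .{{_ : NonZero c}} → n ≤ c * n ^ suc j
n≤c*n^[1+j] c j n = ≤-trans (n≤n^[1+j] n j) (m≤n*m (n ^ suc j) c)

c*t^[1+j]≤N<c*[1+t]^[1+j] : ∀ c j {N T} .{{_ : NonZero c}} → c * T ^ suc j ≤ N →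
  ∃ λ t → T ≤ t × c * t ^ suc j ≤ N × N < c * suc t ^ suc j
c*t^[1+j]≤N<c*[1+t]^[1+j] c j {N} {T} cT^[1+j]≤N =
  let t , T≤t , ct^[1+j]≤N , c[1+t]^[1+j]≰N =
        lastBefore (λ t → c * t ^ suc j ≤? N) (suc N ∸ T) cT^[1+j]≤N ¬P[1+N]
  in t , T≤t , ct^[1+j]≤N , ≰⇒> c[1+t]^[1+j]≰N
  where
  ¬P[1+N] : ¬ (c * (suc N ∸ T + T) ^ suc j ≤ N)
  ¬P[1+N] rewrite m∸n+n≡m (≤-trans (n≤c*n^[1+j] c j T) (≤-trans cT^[1+j]≤N (n≤1+n N))) =
    <⇒≱ (n≤c*n^[1+j] c j (suc N))

t*[1+t]^j≤t^j*[t+2j] : ∀ j t → 2 * j ≤ t → t * suc t ^ j ≤ t ^ j * (t + 2 * j)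
t*[1+t]^j≤t^j*[t+2j] zero t _ = ≤-reflexive (trans (*-identityʳ t) (sym (trans (*-identityˡ (t + 0)) (+-identityʳ t))))
t*[1+t]^j≤t^j*[t+2j] (suc j) t 2[1+j]≤t = step (t*[1+t]^j≤t^j*[t+2j] j t 2j≤t)
  where
  2j≤t : 2 * j ≤ t
  2j≤t = ≤-trans (*-monoʳ-≤ 2 (n≤1+n j)) 2[1+j]≤t
  t+t+t[t+2j]≡t[t+2[1+j]] : ∀ t j → t + t + t * (t + 2 * j) ≡ t * (t + 2 * suc j)
  t+t+t[t+2j]≡t[t+2[1+j]] = solve-∀
  step : ∀ {X Y} → t * X ≤ Y * (t + 2 * j) → t * (suc t * X) ≤ t * Y * (t + 2 * suc j)
  step {X} {Y} tX≤Y[t+2j] = begin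
    t * (suc t * X)                   ≡⟨ x∙yz≈y∙xz t (suc t) X ⟩
    suc t * (t * X)                   ≤⟨ *-monoʳ-≤ (suc t) tX≤Y[t+2j] ⟩
    suc t * (Y * (t + 2 * j))         ≡⟨ x∙yz≈y∙xz (suc t) Y (t + 2 * j) ⟩
    Y * (t + 2 * j + t * (t + 2 * j)) ≤⟨ *-monoʳ-≤ Y (+-monoˡ-≤ (t * (t + 2 * j)) (+-monoʳ-≤ t 2j≤t)) ⟩
    Y * (t + t + t * (t + 2 * j))     ≡⟨ cong (Y *_) (t+t+t[t+2j]≡t[t+2[1+j]] t j) ⟩
    Y * (t * (t + 2 * suc j))         ≡⟨ xy∙z≈y∙xz t Y (t + 2 * suc j) ⟨
    t * Y * (t + 2 * suc j)           ∎
    where open ≤-Reasoning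

k*Y<[1+k]*X : ∀ k t d {X Y} → t * Y ≤ X * (t + d) → d * k < t → 0 < X → k * Y < suc k * X
k*Y<[1+k]*X k t d {X} {Y} tY≤X[t+d] dk<t 0<X = *-cancelˡ-< t (k * Y) (suc k * X) (begin-strict
  t * (k * Y)                 ≡⟨ x∙yz≈y∙xz t k Y ⟩
  k * (t * Y)                 ≤⟨ *-monoʳ-≤ k tY≤X[t+d] ⟩
  k * (X * (t + d))           ≡⟨ expand k X t d ⟩
  X * (k * t) + X * (d * k)   <⟨ +-monoʳ-< (X * (k * t)) (*-monoʳ-< X {{>-nonZero 0<X}} dk<t) ⟩
  X * (k * t) + X * t         ≡⟨ collect X k t ⟩
  t * (suc k * X)             ∎)
  where
  open ≤-Reasoning
  expand : ∀ k X t d → k * (X * (t + d)) ≡ X * (k * t) + X * (d * k)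
  expand = solve-∀
  collect : ∀ X k t → X * (k * t) + X * t ≡ t * (suc k * X)
  collect = solve-∀

k*[1+t]^m<[1+k]*t^m : ∀ m k t → 2 * m * k < t → k * suc t ^ m < suc k * t ^ m
k*[1+t]^m<[1+k]*t^m m zero t@(suc _) _ = subst (0 <_) (sym (+-identityʳ (t ^ m))) (m^n>0 t m)
k*[1+t]^m<[1+k]*t^m m (suc k) t@(suc _) 2m[1+k]<t =
  k*Y<[1+k]*X (suc k) t (2 * m) (t*[1+t]^j≤t^j*[t+2j] m t 2m≤t) 2m[1+k]<t (m^n>0 t m)
  where
  2m≤t : 2 * m ≤ t
  2m≤t = ≤-trans (m≤m*n (2 * m) (suc k)) (<⇒≤ 2m[1+k]<t)

^-distrib-* : ∀ x y n → (x * y) ^ n ≡ x ^ n * y ^ n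
^-distrib-* x y zero = refl
^-distrib-* x y (suc n) = trans (cong (x * y *_) (^-distrib-* x y n)) (interchange x y (x ^ n) (y ^ n))

product-replicate : ∀ n a → product (replicate n a) ≡ a ^ n
product-replicate zero a = refl
product-replicate (suc n) a = cong (a *_) (product-replicate n a)

last-++-∷ : ∀ {A : Set} (xs : List A) {y ys} → last (xs ++ y ∷ ys) ≡ last (y ∷ ys)
last-++-∷ [] = refl
last-++-∷ (x ∷ []) = refl
last-++-∷ (x ∷ x' ∷ xs) = last-++-∷ (x' ∷ xs)

Linked-replicate-++ : ∀ n {a y ys} → a ≤ y → Linked _≤_ (y ∷ ys) → Linked _≤_ (replicate n a ++ y ∷ ys)
Linked-replicate-++ zero _ sorted = sorted
Linked-replicate-++ (suc zero) a≤y sorted = a≤y ∷ sorted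
Linked-replicate-++ (suc (suc n)) a≤y sorted = ≤-refl ∷ Linked-replicate-++ (suc n) a≤y sorted

count-replicate-++-pair : ∀ n x {a u b} → a < u → u < b → count x (replicate (suc n) a ++ u ∷ b ∷ []) ≤ suc n
count-replicate-++-pair n x {a} {u} {b} a<u u<b with x ≟ a
... | yes refl = ≤-reflexive (begin
  count x (replicate (suc n) x ++ u ∷ b ∷ [])       ≡⟨ count-++ x (replicate (suc n) x) (u ∷ b ∷ []) ⟩
  count x (replicate (suc n) x) + count x (u ∷ b ∷ []) ≡⟨ cong₂ _+_ (count-replicate (suc n) x) x∉ub ⟩
  suc n + 0                                         ≡⟨ +-identityʳ (suc n) ⟩
  suc n                                             ∎)
  where
  open ≡-Reasoning
  x∉ub : count x (u ∷ b ∷ []) ≡ 0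
  x∉ub = count-≡0 (<⇒≢ a<u ∷ <⇒≢ (<-trans a<u u<b) ∷ [])
... | no x≢a = begin
  count x (replicate (suc n) a ++ u ∷ b ∷ [])       ≡⟨ count-++ x (replicate (suc n) a) (u ∷ b ∷ []) ⟩
  count x (replicate (suc n) a) + count x (u ∷ b ∷ []) ≡⟨ cong (_+ count x (u ∷ b ∷ [])) (count-≡0 (replicate⁺ (suc n) x≢a)) ⟩
  count x (u ∷ b ∷ [])                              ≤⟨ count-pair-≤1 x (<⇒≢ u<b) ⟩
  1                                                 ≤⟨ s≤s z≤n ⟩
  suc n                                             ∎
  where open ≤-Reasoning

replicate-++-pair-SeqFromTo : ∀ i {a u b} → a < u → u < b →
  (∃ λ R → a ^ suc i * (u * b) ≡ R ^ suc (suc i)) → SeqFromTo (suc (suc i)) a b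
replicate-++-pair-SeqFromTo i {a} {u} {b} a<u u<b (R , a^[1+i]*u*b≡R^m) =
  xs , (sorted , (R , product-xs) , λ x → count-replicate-++-pair i x a<u u<b) ,
  refl , last-++-∷ (replicate (suc i) a)
  where
  xs : List ℕ
  xs = replicate (suc i) a ++ u ∷ b ∷ []
  sorted : Linked _≤_ xs
  sorted = Linked-replicate-++ (suc i) (<⇒≤ a<u) (<⇒≤ u<b ∷ [-])
  product-xs : product xs ≡ R ^ suc (suc i)
  product-xs = begin
    product xs                                    ≡⟨ product-++ (replicate (suc i) a) (u ∷ b ∷ []) ⟩
    product (replicate (suc i) a) * (u * (b * 1)) ≡⟨ cong₂ (λ p q → p * (u * q)) (product-replicate (suc i) a) (*-identityʳ b) ⟩
    a ^ suc i * (u * b)                           ≡⟨ a^[1+i]*u*b≡R^m ⟩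
    R ^ suc (suc i)                               ∎
    where open ≡-Reasoning

scale : ℕ → ℕ → ℕ
scale m k = k * suc k ^ (m ∸ 1)

scale≢0 : ∀ m k .{{_ : NonZero k}} → NonZero (scale m k)
scale≢0 m k {{k≢0}} = m*n≢0 k (suc k ^ (m ∸ 1)) {{k≢0}} {{m^n≢0 (suc k) (m ∸ 1)}}

threshold : ℕ → ℕ → ℕ
threshold m k = scale m k * suc (2 * m * k) ^ m

SeqFromTo-kr-[1+k]r : ∀ i k r t .{{_ : NonZero k}} → let m = suc (suc i) in
  2 * m * k < t → scale m k * t ^ m ≤ k * r → k * r < scale m k * suc t ^ m →
  SeqFromTo m (k * r) (suc k * r)
SeqFromTo-kr-[1+k]r i k r t 2mk<t ct^m≤kr kr<u =
  replicate-++-pair-SeqFromTo i kr<u u<[1+k]r (k * suc k * r * suc t , product≡R^m)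
  where
  m = suc (suc i)
  c = scale m k
  instance
    c≢0 : NonZero c
    c≢0 = scale≢0 m k
  u<[1+k]r : c * suc t ^ m < suc k * r
  u<[1+k]r = *-cancelˡ-< k _ _ (begin-strict
    k * (c * suc t ^ m)  ≡⟨ x∙yz≈y∙xz k c (suc t ^ m) ⟩
    c * (k * suc t ^ m)  <⟨ *-monoʳ-< c (k*[1+t]^m<[1+k]*t^m m k t 2mk<t) ⟩
    c * (suc k * t ^ m)  ≡⟨ x∙yz≈y∙xz c (suc k) (t ^ m) ⟩
    suc k * (c * t ^ m)  ≤⟨ *-monoʳ-≤ (suc k) ct^m≤kr ⟩
    suc k * (k * r)      ≡⟨ x∙yz≈y∙xz (suc k) k r ⟩
    k * (suc k * r)      ∎)
    where open ≤-Reasoning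
  regroup : ∀ k K r kʲ Kʲ rʲ sᵐ → kʲ * rʲ * (k * Kʲ * sᵐ * (K * r)) ≡ k * kʲ * (K * Kʲ) * (r * rʲ) * sᵐ
  regroup = solve-∀
  product≡R^m : (k * r) ^ suc i * (c * suc t ^ m * (suc k * r)) ≡ (k * suc k * r * suc t) ^ m
  product≡R^m = begin
    (k * r) ^ suc i * (c * suc t ^ m * (suc k * r))
      ≡⟨ cong (_* (c * suc t ^ m * (suc k * r))) (^-distrib-* k r (suc i)) ⟩
    k ^ suc i * r ^ suc i * (c * suc t ^ m * (suc k * r))
      ≡⟨ regroup k (suc k) r (k ^ suc i) (suc k ^ suc i) (r ^ suc i) (suc t ^ m) ⟩
    k ^ m * suc k ^ m * r ^ m * suc t ^ m
      ≡⟨ cong (_* suc t ^ m) (cong (_* r ^ m) (^-distrib-* k (suc k) m)) ⟨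
    (k * suc k) ^ m * r ^ m * suc t ^ m
      ≡⟨ cong (_* suc t ^ m) (^-distrib-* (k * suc k) r m) ⟨
    (k * suc k * r) ^ m * suc t ^ m
      ≡⟨ ^-distrib-* (k * suc k * r) (suc t) m ⟨
    (k * suc k * r * suc t) ^ m ∎
    where open ≡-Reasoning

lemma4p4 : ∀ (m k : ℕ) → 2 ≤ m → 1 ≤ k →
    ∃ λ C → ∀ (r : ℕ) → C < r →
    ∃ λ s → IsG m (k * r) s × s ≤ suc k * r
lemma4p4 m@(suc (suc i)) k@(suc _) _ _ = threshold m k , λ r C<r →
  let t , 2mk<t , ct^m≤kr , kr<c[1+t]^m =
        c*t^[1+j]≤N<c*[1+t]^[1+j] (scale m k) (suc i) {{scale≢0 m k}} (≤-trans (<⇒≤ C<r) (m≤n*m r k))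
  in SeqFromTo⇒∃IsG (SeqFromTo-kr-[1+k]r i k r t 2mk<t ct^m≤kr kr<c[1+t]^m)
lemma4p4 (suc zero) _ (s≤s ()) _
lemma4p4 zero _ () _
lemma4p4 (suc (suc _)) zero _ ()
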